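{- For every positive integer $t$, the independent set sequence $(i_k(S_{t,2}))_{k=0}^{t+1}$ of the tree $S_{t,2}$ is log-concave, i.e. $i_k(S_{t,2})^2 \ge i_{k-1}(S_{t,2})\, i_{k+1}(S_{t,2})$ for all $1 \le k \le t$.
   Context: $S_{t,2}$ is the tree consisting of $t$ paths of length $2$ (each with $2$ edges) all sharing a common start vertex; i.e. a central vertex $r$ adjacent to vertices $a_1,\dots,a_t$, with each $a_j$ adjacent to one further leaf $b_j$ (so $S_{t,2}$ has $2t+1$ vertices and independence number $t+1$). For a graph $G$, an independent set is a set of pairwise non-adjacent vertices, and $i_k(G)$ is the number of independent sets in $G$ of cardinality $k$. A sequence $(a_k)_{k=0}^n$ is log-concave if $a_k^2 \ge a_{k-1}a_{k+1}$ for all $1 \le k \le n-1$. -}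

module Defs where

open import Data.Nat using (ℕ; zero; suc; _+_; _*_; _≡ᵇ_; _<ᵇ_)
open import Data.Bool using (Bool; true; false; _∧_; _∨_; not; if_then_else_)
open import Data.Fin using (Fin; toℕ)
open import Data.Fin.Subset using (Subset; ∣_∣; _∈_)
open import Data.Fin.Subset.Properties using (_∈?_)
open import Data.Vec using (Vec; []; _∷_)
open import Data.List using (List; []; _∷_; map; _++_; length; allFin; foldr)
open import Relation.Nullary.Decidable using (⌊_⌋)
open import Relation.Binary.PropositionalEquality using (_≡_)

-- A finite simple graph on vertex set Fin n, given by a Boolean adjacency
-- function (the graph notions below only use it symmetrically).
record Graph (n : ℕ) : Set where
  field
    adj : Fin n → Fin n → Bool
open Graph public

allB : {A : Set} → (A → Bool) → List A → Bool
allB p = foldr (λ x b → p x ∧ b) true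

filterB : {A : Set} → (A → Bool) → List A → List A
filterB p [] = []
filterB p (x ∷ xs) = if p x then x ∷ filterB p xs else filterB p xs

allSubsets : (n : ℕ) → List (Subset n)
allSubsets zero = [] ∷ []
allSubsets (suc n) = map (false ∷_) (allSubsets n) ++ map (true ∷_) (allSubsets n)

isIndependent : {n : ℕ} → Graph n → Subset n → Bool
isIndependent {n} G S =
  allB (λ u → allB (λ v → not (⌊ u ∈? S ⌋ ∧ ⌊ v ∈? S ⌋ ∧ adj G u v)) (allFin n)) (allFin n)

indepCount : {n : ℕ} → Graph n → ℕ → ℕ
indepCount {n} G k =
  length (filterB (λ S → isIndependent G S ∧ (∣ S ∣ ≡ᵇ k)) (allSubsets n))

-- S_{t,2}: vertices Fin (1 + t + t); vertex 0 is the centre r,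
-- vertex j (1 ≤ j ≤ t) is a_j, vertex t + j (1 ≤ j ≤ t) is b_j.
-- Edges: r — a_j and a_j — b_j for each 1 ≤ j ≤ t.
isA : ℕ → ℕ → Bool
isA t x = (0 <ᵇ x) ∧ (x <ᵇ suc t)

spiderEdge : (t : ℕ) → ℕ → ℕ → Bool
spiderEdge t x y = ((x ≡ᵇ 0) ∧ isA t y) ∨ (isA t x ∧ (y ≡ᵇ x + t))

S-t2 : (t : ℕ) → Graph (suc (t + t))
S-t2 t = record { adj = λ u v → spiderEdge t (toℕ u) (toℕ v) ∨ spiderEdge t (toℕ v) (toℕ u) }

-- A set in S_{t,2} either avoids the centre r, and then meets each path
-- r–a_j–b_j in nothing, a_j or b_j, or contains r, and then consists of b_j's
-- only; hence i_k = 2^k C(t,k) + C(t,k-1). Writing k = j+1, P = 2^j and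
-- x, y, z, w = C(t,j-1), …, C(t,j+2), the claim becomes
-- (P y + x)(4P w + z) ≤ (2P z + y)². After expanding, x z ≤ y² and x w ≤ y z
-- follow from the decreasing ratios of consecutive binomial coefficients, and
-- 4P² y w + P y z ≤ 4P² z² uses in addition P > j.
module Submission where

open import Defs
open import Function using (_∘_)
open import Function.Bundles using (_⇔_; mk⇔; Equivalence)
import Function.Properties.Equivalence as ⇔
open import Data.Nat
open import Data.Nat.Properties
open import Data.Nat.Combinatorics using (_C_; nCn≡1; nC1≡n; nCk≡nC[n∸k]; k>n⇒nCk≡0; nCk+nC[k+1]≡[n+1]C[k+1])
open import Data.Nat.ListAction using (sum)
open import Data.Nat.ListAction.Properties using (sum-++)
open import Data.Nat.Tactic.RingSolver using (solve; solve-∀)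
open import Data.Bool using (Bool; true; false; _∧_; _∨_; not; T)
open import Data.Bool.Properties using (T-∧; T-∨; T-≡; ⇔→≡; ∧-zeroʳ)
open import Data.Unit using (tt)
open import Data.Empty using (⊥-elim)
open import Data.Product using (_,_; proj₁; proj₂)
open import Data.Sum using (inj₁; [_,_]′)
open import Data.Fin using (Fin; toℕ; fromℕ<) renaming (zero to fzero; suc to fsuc)
open import Data.Fin.Properties using (toℕ-fromℕ<)
open import Data.Fin.Subset using (Subset; ∣_∣)
open import Data.Fin.Subset.Properties using (_∈?_)
open import Data.List using ([]; _∷_; map; length; allFin) renaming (_++_ to _++ˡ_)
open import Data.List.Properties using (map-++; map-∘)
open import Data.List.Relation.Unary.Any using (here; there)
open import Data.List.Membership.Propositional using (_∈_)
open import Data.List.Membership.Propositional.Properties using (∈-allFin)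
open import Relation.Nullary using (¬_)
open import Relation.Nullary.Decidable using (⌊_⌋; ⌊⌋-map′)
open import Relation.Binary.PropositionalEquality

open Equivalence using (to; from)

private variable
  m n t : ℕ

nC0≡1 : ∀ n → n C 0 ≡ 1
nC0≡1 n = trans (nCk≡nC[n∸k] {n = n} z≤n) (nCn≡1 n)

[k+1]*nC[k+1]+k*nCk≡n*nCk : ∀ n k → suc k * (n C suc k) + k * (n C k) ≡ n * (n C k)
[k+1]*nC[k+1]+k*nCk≡n*nCk zero zero = refl
[k+1]*nC[k+1]+k*nCk≡n*nCk zero (suc k) = begin
  (2 + k) * (0 C (2 + k)) + suc k * (0 C suc k)
    ≡⟨ cong₂ (λ u v → (2 + k) * u + suc k * v) (k>n⇒nCk≡0 {0} {2 + k} (s≤s z≤n)) (k>n⇒nCk≡0 {0} {suc k} (s≤s z≤n)) ⟩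
  (2 + k) * 0 + suc k * 0
    ≡⟨ cong₂ _+_ (*-zeroʳ (2 + k)) (*-zeroʳ (suc k)) ⟩
  0 ∎
  where open ≡-Reasoning
[k+1]*nC[k+1]+k*nCk≡n*nCk (suc n) zero
  rewrite nC1≡n (suc n) | nC0≡1 (suc n) = trans (+-identityʳ (1 * suc n)) (*-comm 1 (suc n))
[k+1]*nC[k+1]+k*nCk≡n*nCk (suc n) (suc k) = begin
  (2 + k) * (suc n C (2 + k)) + (1 + k) * (suc n C suc k)
    ≡⟨ sym (cong₂ (λ u v → (2 + k) * u + (1 + k) * v) (nCk+nC[k+1]≡[n+1]C[k+1] n (suc k)) (nCk+nC[k+1]≡[n+1]C[k+1] n k)) ⟩
  (2 + k) * (b + c) + (1 + k) * (a + b)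
    ≡⟨ regroup k a b c ⟩
  ((1 + k) * b + k * a) + a + ((2 + k) * c + (1 + k) * b) + b
    ≡⟨ cong₂ (λ u v → u + a + v + b) ([k+1]*nC[k+1]+k*nCk≡n*nCk n k) ([k+1]*nC[k+1]+k*nCk≡n*nCk n (suc k)) ⟩
  n * a + a + n * b + b
    ≡⟨ collect n a b ⟩
  suc n * (a + b)
    ≡⟨ cong (suc n *_) (nCk+nC[k+1]≡[n+1]C[k+1] n k) ⟩
  suc n * (suc n C suc k) ∎
  where
  open ≡-Reasoning
  a = n C k
  b = n C suc k
  c = n C suc (suc k)
  regroup : ∀ k a b c → (2 + k) * (b + c) + (1 + k) * (a + b) ≡ ((1 + k) * b + k * a) + a + ((2 + k) * c + (1 + k) * b) + b
  regroup = solve-∀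
  collect : ∀ n a b → n * a + a + n * b + b ≡ (1 + n) * (a + b)
  collect = solve-∀

[k+1]*nC[k+1]≡m*nCk : ∀ {n} k m → k + m ≡ n → suc k * (n C suc k) ≡ m * (n C k)
[k+1]*nC[k+1]≡m*nCk {n} k m k+m≡n = +-cancelʳ-≡ (k * (n C k)) _ _ (begin
  suc k * (n C suc k) + k * (n C k) ≡⟨ [k+1]*nC[k+1]+k*nCk≡n*nCk n k ⟩
  n * (n C k)                       ≡⟨ cong (_* (n C k)) (trans (sym k+m≡n) (+-comm k m)) ⟩
  (m + k) * (n C k)                 ≡⟨ *-distribʳ-+ (n C k) m k ⟩
  m * (n C k) + k * (n C k)         ∎)
  where open ≡-Reasoning

prev : (ℕ → ℕ) → ℕ → ℕ
prev f zero    = 0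
prev f (suc k) = f k

prev-cong : ∀ {f g : ℕ → ℕ} → (∀ k → f k ≡ g k) → ∀ k → prev f k ≡ prev g k
prev-cong f≗g zero    = refl
prev-cong f≗g (suc k) = f≗g k

k*nCk≡[1+m]*prev : ∀ {n} k m → k + m ≡ n → k * (n C k) ≡ suc m * prev (n C_) k
k*nCk≡[1+m]*prev zero    m _     = sym (*-zeroʳ (suc m))
k*nCk≡[1+m]*prev (suc k) m k+m≡n = [k+1]*nC[k+1]≡m*nCk k (suc m) (trans (+-suc k m) k+m≡n)

n<2^n : ∀ n → n < 2 ^ n
n<2^n zero = s≤s z≤n
n<2^n (suc n) = begin-strict
  suc n           ≤⟨ n<2^n n ⟩
  2 ^ n           <⟨ m<m+n (2 ^ n) (m^n>0 2 n) ⟩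
  2 ^ n + 2 ^ n   ≡⟨ cong (2 ^ n +_) (sym (+-identityʳ (2 ^ n))) ⟩
  2 ^ suc n       ∎
  where open ≤-Reasoning

-- With t = j + m + 1, the hypotheses hold for x, y, z, w = C(t,j-1), …, C(t,j+2).
module ConsecutiveRatios (j m x y z w : ℕ)
  (r₀ : j * y ≡ (2 + m) * x) (r₁ : (1 + j) * z ≡ (1 + m) * y) (r₂ : (2 + j) * w ≡ m * z) where

  open ≤-Reasoning

  x*z≤y*y : x * z ≤ y * y
  x*z≤y*y = *-cancelˡ-≤ ((1 + j) * (2 + m)) (begin
    (1 + j) * (2 + m) * (x * z)   ≡⟨ solve (m ∷ j ∷ x ∷ z ∷ []) ⟩
    ((2 + m) * x) * ((1 + j) * z) ≡⟨ cong₂ _*_ (sym r₀) r₁ ⟩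
    (j * y) * ((1 + m) * y)       ≡⟨ solve (j ∷ m ∷ y ∷ []) ⟩
    (j * (1 + m)) * (y * y)       ≤⟨ *-monoˡ-≤ (y * y) (*-mono-≤ (n≤1+n j) (n≤1+n (1 + m))) ⟩
    (1 + j) * (2 + m) * (y * y)   ∎)

  x*w≤y*z : x * w ≤ y * z
  x*w≤y*z = *-cancelˡ-≤ ((2 + j) * (2 + m)) (begin
    (2 + j) * (2 + m) * (x * w)   ≡⟨ solve (m ∷ j ∷ x ∷ w ∷ []) ⟩
    ((2 + m) * x) * ((2 + j) * w) ≡⟨ cong₂ _*_ (sym r₀) r₂ ⟩
    (j * y) * (m * z)             ≡⟨ solve (j ∷ m ∷ y ∷ z ∷ []) ⟩
    (j * m) * (y * z)             ≤⟨ *-monoˡ-≤ (y * z) (*-mono-≤ (m≤n+m j 2) (m≤n+m m 2)) ⟩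
    (2 + j) * (2 + m) * (y * z)   ∎)

  Q*y*w+z*y≤Q*z*z : ∀ Q → j < Q → Q * (y * w) + z * y ≤ Q * (z * z)
  Q*y*w+z*y≤Q*z*z Q j<Q = *-cancelˡ-≤ ((1 + m) * (2 + j)) (begin
    (1 + m) * (2 + j) * (Q * (y * w) + z * y)
      ≡⟨ solve (m ∷ j ∷ Q ∷ y ∷ z ∷ w ∷ []) ⟩
    Q * (((1 + m) * y) * ((2 + j) * w)) + (2 + j) * z * ((1 + m) * y)
      ≡⟨ cong₂ (λ a b → Q * (a * b) + (2 + j) * z * a) (sym r₁) r₂ ⟩
    Q * (((1 + j) * z) * (m * z)) + (2 + j) * z * ((1 + j) * z)
      ≡⟨ solve (m ∷ j ∷ Q ∷ z ∷ []) ⟩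
    (Q * ((1 + j) * m) + (1 + j) * (2 + j)) * (z * z)
      ≤⟨ *-monoˡ-≤ (z * z) (+-monoʳ-≤ (Q * ((1 + j) * m)) (*-mono-≤ j<Q (m≤m+n (2 + j) m))) ⟩
    (Q * ((1 + j) * m) + Q * (2 + j + m)) * (z * z)
      ≡⟨ solve (m ∷ j ∷ Q ∷ z ∷ []) ⟩
    (1 + m) * (2 + j) * (Q * (z * z)) ∎)

  spider-logConcave : ∀ P → j < P →
    (P * y + x) * (2 * (2 * P) * w + z) ≤ (2 * P * z + y) * (2 * P * z + y)
  spider-logConcave P j<P = begin
    (P * y + x) * (2 * (2 * P) * w + z)
      ≡⟨ solve (P ∷ x ∷ y ∷ z ∷ w ∷ []) ⟩
    P * (2 * (2 * P) * (y * w) + z * y) + 2 * (2 * P) * (x * w) + x * z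
      ≤⟨ +-mono-≤ (+-mono-≤ (*-monoʳ-≤ P (Q*y*w+z*y≤Q*z*z (2 * (2 * P)) j<4P))
                            (*-monoʳ-≤ (2 * (2 * P)) x*w≤y*z))
                  x*z≤y*y ⟩
    P * (2 * (2 * P) * (z * z)) + 2 * (2 * P) * (y * z) + y * y
      ≡⟨ solve (P ∷ y ∷ z ∷ []) ⟩
    (2 * P * z + y) * (2 * P * z + y) ∎
    where
    j<4P : j < 2 * (2 * P)
    j<4P = ≤-trans j<P (≤-trans (m≤n*m P 4) (≤-reflexive (*-assoc 2 2 P)))

-- Opened only now, so that the list constructors in the solver calls above are unambiguous.
open import Data.Vec using (Vec; []; _∷_; _++_)

T-not-∧₃ : ∀ {a b c} → T (not (a ∧ b ∧ c)) ⇔ (T a → T b → ¬ T c)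
T-not-∧₃ {false} = mk⇔ (λ _ ()) (λ _ → tt)
T-not-∧₃ {true} {false} = mk⇔ (λ _ _ ()) (λ _ → tt)
T-not-∧₃ {true} {true} {false} = mk⇔ (λ _ _ _ ()) (λ _ → tt)
T-not-∧₃ {true} {true} {true} = mk⇔ (λ ()) (λ f → f tt tt tt)

T-not-∨ : ∀ a {b} → T (not a ∨ b) ⇔ (T a → T b)
T-not-∨ false = mk⇔ (λ _ ()) (λ _ → tt)
T-not-∨ true  = mk⇔ (λ b _ → b) (λ f → f tt)

T-⇔⇒≡ : ∀ {a b} → T a ⇔ T b → a ≡ b
T-⇔⇒≡ h = ⇔→≡ (⇔.trans (⇔.sym T-≡) (⇔.trans h T-≡))

T-allB : ∀ {A : Set} (p : A → Bool) xs → T (allB p xs) ⇔ (∀ {x} → x ∈ xs → T (p x))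
T-allB p [] = mk⇔ (λ _ ()) (λ _ → tt)
T-allB p (x ∷ xs) = mk⇔
  (λ h → let px , pxs = to T-∧ h in λ { (here refl) → px ; (there x∈xs) → to (T-allB p xs) pxs x∈xs })
  (λ h → from T-∧ (h (here refl) , from (T-allB p xs) (λ x∈xs → h (there x∈xs))))

T-allB-allFin : ∀ (p : Fin n → Bool) → T (allB p (allFin n)) ⇔ (∀ i → T (p i))
T-allB-allFin p = mk⇔ (λ h i → to (T-allB p (allFin _)) h (∈-allFin i)) (λ h → from (T-allB p (allFin _)) (λ {i} _ → h i))

bit : Vec Bool n → ℕ → Bool
bit []      _       = false
bit (b ∷ v) zero    = b
bit (b ∷ v) (suc i) = bit v i

⌊∈?⌋≡bit : ∀ (u : Fin n) (p : Subset n) → ⌊ u ∈? p ⌋ ≡ bit p (toℕ u)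
⌊∈?⌋≡bit fzero    (true ∷ p)  = refl
⌊∈?⌋≡bit fzero    (false ∷ p) = refl
⌊∈?⌋≡bit (fsuc u) (b ∷ p)     = trans (⌊⌋-map′ _ _ (u ∈? p)) (⌊∈?⌋≡bit u p)

bit-true⇒< : ∀ (v : Vec Bool n) i → T (bit v i) → i < n
bit-true⇒< (b ∷ v) zero    _ = z<s
bit-true⇒< (b ∷ v) (suc i) h = s<s (bit-true⇒< v i h)

bit-++ˡ : ∀ (as : Vec Bool m) (bs : Vec Bool n) {i} → i < m → bit (as ++ bs) i ≡ bit as i
bit-++ˡ (a ∷ as) bs {zero}  _         = refl
bit-++ˡ (a ∷ as) bs {suc i} (s<s i<m) = bit-++ˡ as bs i<m

bit-++ʳ : ∀ (as : Vec Bool m) (bs : Vec Bool n) i → bit (as ++ bs) (i + m) ≡ bit bs i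
bit-++ʳ {m} as bs i = trans (cong (bit (as ++ bs)) (+-comm i m)) (drop as)
  where
  drop : ∀ {m} (as : Vec Bool m) → bit (as ++ bs) (m + i) ≡ bit bs i
  drop []       = refl
  drop (a ∷ as) = drop as

Independent : (ℕ → ℕ → Bool) → Vec Bool n → Set
Independent E S = ∀ x y → T (bit S x) → T (bit S y) → ¬ T (E x y)

graphOf : (ℕ → ℕ → Bool) → Graph n
graphOf E = record { adj = λ u v → E (toℕ u) (toℕ v) }

isIndependent⇔Independent : ∀ (E : ℕ → ℕ → Bool) (S : Subset n) →
  T (isIndependent (graphOf E) S) ⇔ Independent E S
isIndependent⇔Independent {n} E S = mk⇔ forth back
  where
  member : ∀ u → T (bit S (toℕ u)) ⇔ T ⌊ u ∈? S ⌋
  member u = mk⇔ (subst T (sym (⌊∈?⌋≡bit u S))) (subst T (⌊∈?⌋≡bit u S))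

  noEdge : Fin n → Fin n → Bool
  noEdge u v = not (⌊ u ∈? S ⌋ ∧ ⌊ v ∈? S ⌋ ∧ E (toℕ u) (toℕ v))

  allPairs : T (isIndependent (graphOf E) S) ⇔ (∀ u → T (allB (noEdge u) (allFin n)))
  allPairs = T-allB-allFin (λ u → allB (noEdge u) (allFin n))

  forth : T (isIndependent (graphOf E) S) → Independent E S
  forth h x y bx by
    with fromℕ< (bit-true⇒< S x bx) | toℕ-fromℕ< (bit-true⇒< S x bx)
       | fromℕ< (bit-true⇒< S y by) | toℕ-fromℕ< (bit-true⇒< S y by)
  ... | u | refl | v | refl =
    to T-not-∧₃ (to (T-allB-allFin (noEdge u)) (to allPairs h u) v) (to (member u) bx) (to (member v) by)

  back : Independent E S → T (isIndependent (graphOf E) S)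
  back ind = from allPairs λ u → from (T-allB-allFin (noEdge u)) λ v →
    from T-not-∧₃ λ u∈S v∈S → ind (toℕ u) (toℕ v) (from (member u) u∈S) (from (member v) v∈S)

Independent-∨-flip : ∀ (E : ℕ → ℕ → Bool) (S : Vec Bool n) →
  Independent (λ x y → E x y ∨ E y x) S ⇔ Independent E S
Independent-∨-flip E S = mk⇔
  (λ ind x y bx by e → ind x y bx by (from T-∨ (inj₁ e)))
  (λ ind x y bx by e → [ ind x y bx by , ind y x by bx ]′ (to T-∨ e))

data SpiderEdge (t : ℕ) : ℕ → ℕ → Set where
  hub : ∀ {i} → i < t → SpiderEdge t 0 (suc i)
  leg : ∀ {i} → i < t → SpiderEdge t (suc i) (suc (i + t))

T-spiderEdge : ∀ t x y → T (spiderEdge t x y) ⇔ SpiderEdge t x y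
T-spiderEdge t x y = mk⇔ (forth x y) back
  where
  forth : ∀ x y → T (spiderEdge t x y) → SpiderEdge t x y
  forth zero (suc i) e with to T-∨ e
  ... | inj₁ i<ᵇt = hub (<ᵇ⇒< i t i<ᵇt)
  forth (suc i) y e with to T-∧ e
  ... | i<ᵇt , y≡ᵇ = subst (SpiderEdge t (suc i)) (sym (≡ᵇ⇒≡ y (suc (i + t)) y≡ᵇ)) (leg (<ᵇ⇒< i t i<ᵇt))
  back : ∀ {x y} → SpiderEdge t x y → T (spiderEdge t x y)
  back (hub i<t) = from T-∨ (inj₁ (<⇒<ᵇ i<t))
  back (leg {i} i<t) = from T-∧ (<⇒<ᵇ i<t , ≡⇒≡ᵇ (i + t) (i + t) refl)

isEmpty : Vec Bool n → Bool
isEmpty []       = true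
isEmpty (a ∷ as) = not a ∧ isEmpty as

disjoint : Vec Bool n → Vec Bool n → Bool
disjoint []       []       = true
disjoint (a ∷ as) (b ∷ bs) = not (a ∧ b) ∧ disjoint as bs

T-isEmpty : ∀ (as : Vec Bool n) → T (isEmpty as) ⇔ (∀ i → ¬ T (bit as i))
T-isEmpty []           = mk⇔ (λ _ _ ()) (λ _ → tt)
T-isEmpty (true ∷ as)  = mk⇔ (λ ()) (λ h → ⊥-elim (h 0 tt))
T-isEmpty (false ∷ as) = mk⇔
  (λ { h zero () ; h (suc i) → to (T-isEmpty as) h i })
  (λ h → from (T-isEmpty as) (h ∘ suc))

T-disjoint : ∀ (as bs : Vec Bool n) → T (disjoint as bs) ⇔ (∀ i → T (bit as i) → ¬ T (bit bs i))
T-disjoint []           []           = mk⇔ (λ _ _ ()) (λ _ → tt)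
T-disjoint (true ∷ as)  (true ∷ bs)  = mk⇔ (λ ()) (λ h → ⊥-elim (h 0 tt tt))
T-disjoint (true ∷ as)  (false ∷ bs) = mk⇔
  (λ { h zero _ () ; h (suc i) → to (T-disjoint as bs) h i })
  (λ h → from (T-disjoint as bs) (h ∘ suc))
T-disjoint (false ∷ as) (b ∷ bs)     = mk⇔
  (λ { h zero () ; h (suc i) → to (T-disjoint as bs) h i })
  (λ h → from (T-disjoint as bs) (h ∘ suc))

-- The vertex set s ∷ as ++ bs of S-t2 t: s is the centre r, as lists the a_j, bs the b_j.
spiderIndependent : Bool → Vec Bool t → Vec Bool t → Bool
spiderIndependent s as bs = (not s ∨ isEmpty as) ∧ disjoint as bs

Independent⇔spiderIndependent : ∀ s (as bs : Vec Bool t) →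
  Independent (spiderEdge t) (s ∷ as ++ bs) ⇔ T (spiderIndependent s as bs)
Independent⇔spiderIndependent {t} s as bs = mk⇔ forth back
  where
  inAs : ∀ {i} → i < t → T (bit as i) → T (bit (s ∷ as ++ bs) (suc i))
  inAs i<t = subst T (sym (bit-++ˡ as bs i<t))
  inBs : ∀ i → T (bit bs i) → T (bit (s ∷ as ++ bs) (suc (i + t)))
  inBs i = subst T (sym (bit-++ʳ as bs i))

  forth : Independent (spiderEdge t) (s ∷ as ++ bs) → T (spiderIndependent s as bs)
  forth ind = from T-∧ (hubFree , from (T-disjoint as bs) legFree)
    where
    noEdge : ∀ {x y} → SpiderEdge t x y → T (bit (s ∷ as ++ bs) x) → ¬ T (bit (s ∷ as ++ bs) y)
    noEdge {x} {y} e bx by = ind x y bx by (from (T-spiderEdge t x y) e)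
    hubFree : T (not s ∨ isEmpty as)
    hubFree = from (T-not-∨ s) λ ts → from (T-isEmpty as) λ i ai →
      noEdge (hub (bit-true⇒< as i ai)) ts (inAs (bit-true⇒< as i ai) ai)
    legFree : ∀ i → T (bit as i) → ¬ T (bit bs i)
    legFree i ai bi = noEdge (leg i<t) (inAs i<t ai) (inBs i bi)
      where i<t = bit-true⇒< as i ai

  back : T (spiderIndependent s as bs) → Independent (spiderEdge t) (s ∷ as ++ bs)
  back h x y bx by e = noEdge (to (T-spiderEdge t x y) e) bx by
    where
    hubFree : T s → T (isEmpty as)
    hubFree = to (T-not-∨ s) (proj₁ (to T-∧ h))
    legFree : ∀ i → T (bit as i) → ¬ T (bit bs i)
    legFree = to (T-disjoint as bs) (proj₂ (to T-∧ h))
    noEdge : ∀ {x y} → SpiderEdge t x y → T (bit (s ∷ as ++ bs) x) → ¬ T (bit (s ∷ as ++ bs) y)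
    noEdge (hub {i} i<t) ts ai = to (T-isEmpty as) (hubFree ts) i (subst T (bit-++ˡ as bs i<t) ai)
    noEdge (leg {i} i<t) ai bi = legFree i (subst T (bit-++ˡ as bs i<t) ai) (subst T (bit-++ʳ as bs i) bi)

isIndependent-S-t2 : ∀ t s (as bs : Vec Bool t) →
  isIndependent (S-t2 t) (s ∷ as ++ bs) ≡ spiderIndependent s as bs
isIndependent-S-t2 t s as bs = T-⇔⇒≡ (⇔.trans (⇔.trans
  (isIndependent⇔Independent _ (s ∷ as ++ bs))
  (Independent-∨-flip (spiderEdge t) (s ∷ as ++ bs)))
  (Independent⇔spiderIndependent s as bs))

𝟙 : Bool → ℕ
𝟙 false = 0
𝟙 true  = 1

length-filterB : ∀ {A : Set} (p : A → Bool) xs → length (filterB p xs) ≡ sum (map (𝟙 ∘ p) xs)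
length-filterB p []       = refl
length-filterB p (x ∷ xs) with p x
... | true  = cong suc (length-filterB p xs)
... | false = length-filterB p xs

sumBits : ∀ n → (Vec Bool n → ℕ) → ℕ
sumBits zero    f = f []
sumBits (suc n) f = sumBits n (f ∘ (false ∷_)) + sumBits n (f ∘ (true ∷_))

sum-map-allSubsets : ∀ n (f : Subset n → ℕ) → sum (map f (allSubsets n)) ≡ sumBits n f
sum-map-allSubsets zero    f = +-identityʳ (f [])
sum-map-allSubsets (suc n) f = begin
  sum (map f (map (false ∷_) xs ++ˡ map (true ∷_) xs))
    ≡⟨ cong sum (map-++ f (map (false ∷_) xs) _) ⟩
  sum (map f (map (false ∷_) xs) ++ˡ map f (map (true ∷_) xs))
    ≡⟨ sum-++ (map f (map (false ∷_) xs)) _ ⟩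
  sum (map f (map (false ∷_) xs)) + sum (map f (map (true ∷_) xs))
    ≡⟨ sym (cong₂ (λ u v → sum u + sum v) (map-∘ xs) (map-∘ xs)) ⟩
  sum (map (f ∘ (false ∷_)) xs) + sum (map (f ∘ (true ∷_)) xs)
    ≡⟨ cong₂ _+_ (sum-map-allSubsets n _) (sum-map-allSubsets n _) ⟩
  sumBits n (f ∘ (false ∷_)) + sumBits n (f ∘ (true ∷_)) ∎
  where
  open ≡-Reasoning
  xs = allSubsets n

sumBits-cong : ∀ n {f g : Vec Bool n → ℕ} → (∀ v → f v ≡ g v) → sumBits n f ≡ sumBits n g
sumBits-cong zero    f≗g = f≗g []
sumBits-cong (suc n) f≗g = cong₂ _+_ (sumBits-cong n (f≗g ∘ (false ∷_))) (sumBits-cong n (f≗g ∘ (true ∷_)))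

sumBits-zero : ∀ n → sumBits n (λ _ → 0) ≡ 0
sumBits-zero zero    = refl
sumBits-zero (suc n) = cong₂ _+_ (sumBits-zero n) (sumBits-zero n)

sumBits-+ : ∀ n (f g : Vec Bool n → ℕ) → sumBits n (λ v → f v + g v) ≡ sumBits n f + sumBits n g
sumBits-+ zero    f g = refl
sumBits-+ (suc n) f g = begin
  sumBits n (λ v → f (false ∷ v) + g (false ∷ v)) + sumBits n (λ v → f (true ∷ v) + g (true ∷ v))
    ≡⟨ cong₂ _+_ (sumBits-+ n _ _) (sumBits-+ n _ _) ⟩
  (f₀ + g₀) + (f₁ + g₁)
    ≡⟨ +-comm-middle f₀ g₀ f₁ g₁ ⟩
  (f₀ + f₁) + (g₀ + g₁) ∎
  where
  open ≡-Reasoning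
  f₀ = sumBits n (f ∘ (false ∷_))
  f₁ = sumBits n (f ∘ (true ∷_))
  g₀ = sumBits n (g ∘ (false ∷_))
  g₁ = sumBits n (g ∘ (true ∷_))
  +-comm-middle : ∀ a b c d → (a + b) + (c + d) ≡ (a + c) + (b + d)
  +-comm-middle = solve-∀

sumBits-++ : ∀ m n (f : Vec Bool (m + n) → ℕ) → sumBits (m + n) f ≡ sumBits m (λ as → sumBits n (λ bs → f (as ++ bs)))
sumBits-++ zero    n f = refl
sumBits-++ (suc m) n f = cong₂ _+_ (sumBits-++ m n (f ∘ (false ∷_))) (sumBits-++ m n (f ∘ (true ∷_)))

Σ² : ∀ t → (Vec Bool t → Vec Bool t → ℕ) → ℕ
Σ² t f = sumBits t λ as → sumBits t λ bs → f as bs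

Σ²-cong : ∀ t {f g : Vec Bool t → Vec Bool t → ℕ} → (∀ as bs → f as bs ≡ g as bs) → Σ² t f ≡ Σ² t g
Σ²-cong t f≗g = sumBits-cong t λ as → sumBits-cong t (f≗g as)

Σ²-zero : ∀ t → Σ² t (λ _ _ → 0) ≡ 0
Σ²-zero t = trans (sumBits-cong t λ _ → sumBits-zero t) (sumBits-zero t)

Σ²-suc : ∀ t (f : Vec Bool (suc t) → Vec Bool (suc t) → ℕ) → Σ² (suc t) f ≡
  (Σ² t (λ as bs → f (false ∷ as) (false ∷ bs)) + Σ² t (λ as bs → f (false ∷ as) (true ∷ bs))) +
  (Σ² t (λ as bs → f (true ∷ as) (false ∷ bs)) + Σ² t (λ as bs → f (true ∷ as) (true ∷ bs)))
Σ²-suc t f = cong₂ _+_ (sumBits-+ t _ _) (sumBits-+ t _ _)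

pairsOfSize : ∀ t → (Vec Bool t → Vec Bool t → Bool) → ℕ → ℕ
pairsOfSize t B k = Σ² t λ as bs → 𝟙 (B as bs ∧ (∣ as ∣ + ∣ bs ∣ ≡ᵇ k))

pairsOfSize-sucˡ : ∀ t B k →
  Σ² t (λ as bs → 𝟙 (B as bs ∧ (suc (∣ as ∣ + ∣ bs ∣) ≡ᵇ k))) ≡ prev (pairsOfSize t B) k
pairsOfSize-sucˡ t B zero    = trans (Σ²-cong t λ as bs → cong 𝟙 (∧-zeroʳ (B as bs))) (Σ²-zero t)
pairsOfSize-sucˡ t B (suc k) = refl

pairsOfSize-sucʳ : ∀ t B k →
  Σ² t (λ as bs → 𝟙 (B as bs ∧ (∣ as ∣ + suc ∣ bs ∣ ≡ᵇ k))) ≡ prev (pairsOfSize t B) k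
pairsOfSize-sucʳ t B k = trans
  (Σ²-cong t λ as bs → cong (λ s → 𝟙 (B as bs ∧ (s ≡ᵇ k))) (+-suc ∣ as ∣ ∣ bs ∣))
  (pairsOfSize-sucˡ t B k)

disjointPairs-suc : ∀ t k →
  pairsOfSize (suc t) disjoint k ≡ pairsOfSize t disjoint k + 2 * prev (pairsOfSize t disjoint) k
disjointPairs-suc t k = begin
  pairsOfSize (suc t) disjoint k
    ≡⟨ Σ²-suc t (λ as bs → 𝟙 (disjoint as bs ∧ (∣ as ∣ + ∣ bs ∣ ≡ᵇ k))) ⟩
  (p k + _) + (_ + Σ² t (λ _ _ → 0))
    ≡⟨ cong₂ _+_ (cong (p k +_) (pairsOfSize-sucʳ t disjoint k))
                 (cong₂ _+_ (pairsOfSize-sucˡ t disjoint k) (Σ²-zero t)) ⟩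
  (p k + prev p k) + (prev p k + 0)
    ≡⟨ +-assoc (p k) (prev p k) (prev p k + 0) ⟩
  p k + 2 * prev p k ∎
  where
  open ≡-Reasoning
  p = pairsOfSize t disjoint

disjointPairs : ∀ t k → pairsOfSize t disjoint k ≡ 2 ^ k * (t C k)
disjointPairs zero    zero    = refl
disjointPairs zero    (suc k) = sym (trans (cong (2 ^ suc k *_) (k>n⇒nCk≡0 {0} {suc k} z<s)) (*-zeroʳ (2 ^ suc k)))
disjointPairs (suc t) zero    = begin
  pairsOfSize (suc t) disjoint 0 ≡⟨ disjointPairs-suc t 0 ⟩
  pairsOfSize t disjoint 0 + 0   ≡⟨ +-identityʳ _ ⟩
  pairsOfSize t disjoint 0       ≡⟨ disjointPairs t 0 ⟩
  1 * (t C 0)                    ≡⟨ cong (1 *_) (trans (nC0≡1 t) (sym (nC0≡1 (suc t)))) ⟩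
  1 * (suc t C 0)                ∎
  where open ≡-Reasoning
disjointPairs (suc t) (suc k) = begin
  pairsOfSize (suc t) disjoint (suc k)
    ≡⟨ disjointPairs-suc t (suc k) ⟩
  pairsOfSize t disjoint (suc k) + 2 * pairsOfSize t disjoint k
    ≡⟨ cong₂ (λ u v → u + 2 * v) (disjointPairs t (suc k)) (disjointPairs t k) ⟩
  2 * 2 ^ k * (t C suc k) + 2 * (2 ^ k * (t C k))
    ≡⟨ factor (2 ^ k) (t C k) (t C suc k) ⟩
  2 * 2 ^ k * (t C k + t C suc k)
    ≡⟨ cong (2 ^ suc k *_) (nCk+nC[k+1]≡[n+1]C[k+1] t k) ⟩
  2 ^ suc k * (suc t C suc k) ∎
  where
  open ≡-Reasoning
  factor : ∀ P a b → 2 * P * b + 2 * (P * a) ≡ 2 * P * (a + b)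
  factor = solve-∀

emptyLeft : Vec Bool t → Vec Bool t → Bool
emptyLeft as bs = isEmpty as ∧ disjoint as bs

emptyLeftPairs-suc : ∀ t k →
  pairsOfSize (suc t) emptyLeft k ≡ pairsOfSize t emptyLeft k + prev (pairsOfSize t emptyLeft) k
emptyLeftPairs-suc t k = begin
  pairsOfSize (suc t) emptyLeft k
    ≡⟨ Σ²-suc t (λ as bs → 𝟙 (emptyLeft as bs ∧ (∣ as ∣ + ∣ bs ∣ ≡ᵇ k))) ⟩
  (p k + _) + (Σ² t (λ _ _ → 0) + Σ² t (λ _ _ → 0))
    ≡⟨ cong₂ _+_ (cong (p k +_) (pairsOfSize-sucʳ t emptyLeft k)) (cong₂ _+_ (Σ²-zero t) (Σ²-zero t)) ⟩
  (p k + prev p k) + 0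
    ≡⟨ +-identityʳ _ ⟩
  p k + prev p k ∎
  where
  open ≡-Reasoning
  p = pairsOfSize t emptyLeft

emptyLeftPairs : ∀ t k → pairsOfSize t emptyLeft k ≡ t C k
emptyLeftPairs zero    zero    = refl
emptyLeftPairs zero    (suc k) = sym (k>n⇒nCk≡0 {0} {suc k} z<s)
emptyLeftPairs (suc t) zero    = begin
  pairsOfSize (suc t) emptyLeft 0 ≡⟨ emptyLeftPairs-suc t 0 ⟩
  pairsOfSize t emptyLeft 0 + 0   ≡⟨ +-identityʳ _ ⟩
  pairsOfSize t emptyLeft 0       ≡⟨ emptyLeftPairs t 0 ⟩
  t C 0                           ≡⟨ trans (nC0≡1 t) (sym (nC0≡1 (suc t))) ⟩
  suc t C 0                       ∎
  where open ≡-Reasoning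
emptyLeftPairs (suc t) (suc k) = begin
  pairsOfSize (suc t) emptyLeft (suc k)           ≡⟨ emptyLeftPairs-suc t (suc k) ⟩
  pairsOfSize t emptyLeft (suc k) + pairsOfSize t emptyLeft k
                                                  ≡⟨ cong₂ _+_ (emptyLeftPairs t (suc k)) (emptyLeftPairs t k) ⟩
  t C suc k + t C k                               ≡⟨ +-comm (t C suc k) (t C k) ⟩
  t C k + t C suc k                               ≡⟨ nCk+nC[k+1]≡[n+1]C[k+1] t k ⟩
  suc t C suc k                                   ∎
  where open ≡-Reasoning

∣p++q∣≡∣p∣+∣q∣ : ∀ (p : Subset m) (q : Subset n) → ∣ p ++ q ∣ ≡ ∣ p ∣ + ∣ q ∣
∣p++q∣≡∣p∣+∣q∣ []          q = refl
∣p++q∣≡∣p∣+∣q∣ (true ∷ p)  q = cong suc (∣p++q∣≡∣p∣+∣q∣ p q)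
∣p++q∣≡∣p∣+∣q∣ (false ∷ p) q = ∣p++q∣≡∣p∣+∣q∣ p q

indepCount-S-t2 : ∀ t k → indepCount (S-t2 t) k ≡ 2 ^ k * (t C k) + prev (t C_) k
indepCount-S-t2 t k = begin
  indepCount (S-t2 t) k
    ≡⟨ length-filterB _ (allSubsets (suc (t + t))) ⟩
  sum (map f (allSubsets (suc (t + t))))
    ≡⟨ sum-map-allSubsets (suc (t + t)) f ⟩
  sumBits (t + t) (f ∘ (false ∷_)) + sumBits (t + t) (f ∘ (true ∷_))
    ≡⟨ cong₂ _+_ (sumBits-++ t t _) (sumBits-++ t t _) ⟩
  Σ² t (λ as bs → f (false ∷ as ++ bs)) + Σ² t (λ as bs → f (true ∷ as ++ bs))
    ≡⟨ cong₂ _+_ (Σ²-cong t (split false)) (Σ²-cong t (split true)) ⟩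
  pairsOfSize t disjoint k + Σ² t (λ as bs → 𝟙 (emptyLeft as bs ∧ (suc (∣ as ∣ + ∣ bs ∣) ≡ᵇ k)))
    ≡⟨ cong₂ _+_ (disjointPairs t k) (pairsOfSize-sucˡ t emptyLeft k) ⟩
  2 ^ k * (t C k) + prev (pairsOfSize t emptyLeft) k
    ≡⟨ cong (2 ^ k * (t C k) +_) (prev-cong (emptyLeftPairs t) k) ⟩
  2 ^ k * (t C k) + prev (t C_) k ∎
  where
  open ≡-Reasoning
  f : Subset (suc (t + t)) → ℕ
  f S = 𝟙 (isIndependent (S-t2 t) S ∧ (∣ S ∣ ≡ᵇ k))
  split : ∀ s (as bs : Vec Bool t) → f (s ∷ as ++ bs) ≡ 𝟙 (spiderIndependent s as bs ∧ (∣ s ∷ as ∣ + ∣ bs ∣ ≡ᵇ k))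
  split s as bs = cong₂ (λ b n → 𝟙 (b ∧ (n ≡ᵇ k))) (isIndependent-S-t2 t s as bs) (∣p++q∣≡∣p∣+∣q∣ (s ∷ as) bs)

indepCount-S-t2-logConcave : ∀ j m → let i = indepCount (S-t2 (suc j + m)) in i j * i (2 + j) ≤ i (1 + j) * i (1 + j)
indepCount-S-t2-logConcave j m = begin
  i j * i (2 + j)
    ≡⟨ cong₂ _*_ (indepCount-S-t2 N j) (indepCount-S-t2 N (2 + j)) ⟩
  (2 ^ j * (N C j) + prev (N C_) j) * (2 ^ (2 + j) * (N C (2 + j)) + N C (1 + j))
    ≤⟨ spider-logConcave (2 ^ j) (n<2^n j) ⟩
  (2 ^ (1 + j) * (N C (1 + j)) + N C j) * (2 ^ (1 + j) * (N C (1 + j)) + N C j)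
    ≡⟨ sym (cong₂ _*_ (indepCount-S-t2 N (1 + j)) (indepCount-S-t2 N (1 + j))) ⟩
  i (1 + j) * i (1 + j) ∎
  where
  open ≤-Reasoning
  N = suc j + m
  i = indepCount (S-t2 N)
  open ConsecutiveRatios j m (prev (N C_) j) (N C j) (N C suc j) (N C (2 + j))
    (k*nCk≡[1+m]*prev j (suc m) (+-suc j m))
    ([k+1]*nC[k+1]≡m*nCk j (suc m) (+-suc j m))
    ([k+1]*nC[k+1]≡m*nCk (suc j) m refl)

lemma3p3 : (t : ℕ) → 1 ≤ t → (k : ℕ) → 1 ≤ k → k ≤ t →
    indepCount (S-t2 t) k * indepCount (S-t2 t) k ≥ indepCount (S-t2 t) (k ∸ 1) * indepCount (S-t2 t) (suc k)
lemma3p3 t _ zero () _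
lemma3p3 t _ (suc j) _ k≤t with m≤n⇒∃[o]m+o≡n k≤t
... | m , refl = indepCount-S-t2-logConcave j m
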